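{- Let $n\ge 9$ be an integer, let $C_n: v_1v_2\ldots v_nv_1$ be the cycle of order $n$, and let $G=C_n\bar{C}_n$ be its complementary prism, with vertex set $\{v_1,\ldots,v_n\}\cup\{\bar v_1,\ldots,\bar v_n\}$; indices are taken modulo $n$. Let $C\subseteq\{v_1,\ldots,v_n\}$ and $\bar C\subseteq\{\bar v_1,\ldots,\bar v_n\}$ be such that $C\cup\bar C$ is an identifying code in $G$, and let $x_i=1$ iff $v_i\in C$ (else $x_i=0$) and $\bar x_i=1$ iff $\bar v_i\in\bar C$ (else $\bar x_i=0$). Let $\bar I=\{i\in\{1,\ldots,n\}: \bar x_{i-1}+x_i+\bar x_{i+1}=0\}$. Suppose $|\bar C|\ge 6$ and $i\in\{1,\ldots,n\}$ is such that $i-5,i,i+1,i+6\notin\bar I$ and $\bar x_i=\bar x_{i+1}=x_i=x_{i+1}=0$. Then at least one of the following holds: (i) there are subsets $C'\subseteq\{v_1,\ldots,v_n\}$ and $\bar C'\subseteq\{\bar v_1,\ldots,\bar v_n\}$, with characteristic values $x'_j$ ($=1$ iff $v_j\in C'$) and $\bar x'_j$ ($=1$ iff $\bar v_j\in\bar C'$), such that $C'\cup\bar C'$ is an identifying code in $G$ with $|C'\cup\bar C'|\le|C\cup\bar C|$ and $|\{j\in\{1,\ldots,n\}: \bar x'_j=x'_j=0\}|<|\{j\in\{1,\ldots,n\}: \bar x_j=x_j=0\}|$; (ii) for $s=i-1$ or for $s=i-6$, we have, for each $m\in\{0,1,\ldots,8\}$, $\bar x_{s+m}=x_{s+m}=1$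 if $m\in\{0,3,5,8\}$ and $\bar x_{s+m}=x_{s+m}=0$ if $m\in\{1,2,4,6,7\}$ (that is, the pair of rows $(\bar x_s,\ldots,\bar x_{s+8})$ and $(x_s,\ldots,x_{s+8})$ both equal $(1,0,0,1,0,1,0,0,1)$).
   Context: The complementary prism $H\bar{H}$ of a graph $H$ with vertices $v_1,\ldots,v_n$ is the disjoint union of $H$ and its complement $\bar H$ (on vertices $\bar v_1,\ldots,\bar v_n$, where $\bar v_i\bar v_j$ is an edge iff $v_iv_j$ is not an edge of $H$) together with the perfect matching $v_1\bar v_1,\ldots,v_n\bar v_n$. A set $D$ of vertices of a graph $G$ is an identifying code if the sets $N_G[u]\cap D$ (where $N_G[u]$ is the closed neighborhood of $u$) are non-empty and pairwise distinct over all vertices $u$ of $G$. -}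

module Defs where

open import Data.Nat using (ℕ; zero; suc; _+_; _∸_)
open import Data.Nat.DivMod using (_mod_)
open import Data.Fin using (Fin; toℕ) renaming (zero to fzero; suc to fsuc)
open import Data.Bool using (Bool; true; false; if_then_else_; not; _∧_)
open import Data.Sum using (_⊎_; inj₁; inj₂)
open import Data.Product using (_×_; ∃)
open import Data.Vec using (Vec; lookup; _∷_; [])
open import Relation.Nullary using (¬_)
open import Relation.Binary.PropositionalEquality using (_≡_; _≢_)
open import Function.Bundles using (_⇔_)

record Graph : Set₁ where
  field
    V   : Set
    Adj : V → V → Set

open Graph public

ClosedNbhd : (G : Graph) → V G → V G → Set
ClosedNbhd G u z = (z ≡ u) ⊎ Adj G u z

IsIdentifyingCode : (G : Graph) → (V G → Bool) → Set
IsIdentifyingCode G D =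
  ((u : V G) → ∃ λ z → D z ≡ true × ClosedNbhd G u z)
  × ((u w : V G) → u ≢ w →
       ¬ ((z : V G) → (D z ≡ true × ClosedNbhd G u z) ⇔ (D z ≡ true × ClosedNbhd G w z)))

-- Index shift i ↦ i + k (mod n) on Fin n (vertex v_{i+1} is index i, 0-based).
shift : {n : ℕ} → Fin n → ℕ → Fin n
shift {zero} () k
shift {suc m} i k = (toℕ i + k) mod (suc m)

-- i ↦ i - k (mod n), valid for k ≤ n.
unshift : {n : ℕ} → Fin n → ℕ → Fin n
unshift {n} i k = shift i (n ∸ k)

CycleAdj : (n : ℕ) → Fin n → Fin n → Set
CycleAdj n i j = (shift i 1 ≡ j) ⊎ (shift j 1 ≡ i)

-- Complementary prism H H̄ of a graph H on Fin n:
-- vertices inj₁ i = v_i, inj₂ i = v̄_i.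
ComplementaryPrism : (n : ℕ) → (Fin n → Fin n → Set) → Graph
ComplementaryPrism n A = record { V = Fin n ⊎ Fin n ; Adj = adj }
  where
  adj : Fin n ⊎ Fin n → Fin n ⊎ Fin n → Set
  adj (inj₁ i) (inj₁ j) = A i j
  adj (inj₂ i) (inj₂ j) = (i ≢ j) × ¬ A i j
  adj (inj₁ i) (inj₂ j) = i ≡ j
  adj (inj₂ i) (inj₁ j) = i ≡ j

CnBar : (n : ℕ) → Graph
CnBar n = ComplementaryPrism n (CycleAdj n)

codeOf : {n : ℕ} → (Fin n → Bool) → (Fin n → Bool) → Fin n ⊎ Fin n → Bool
codeOf x xb (inj₁ i) = x i
codeOf x xb (inj₂ i) = xb i

countT : {n : ℕ} → (Fin n → Bool) → ℕ
countT {zero} f = 0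
countT {suc n} f = (if f fzero then 1 else 0) + countT (λ j → f (fsuc j))

codeSize : {n : ℕ} → (Fin n → Bool) → (Fin n → Bool) → ℕ
codeSize x xb = countT x + countT xb

zeroCount : {n : ℕ} → (Fin n → Bool) → (Fin n → Bool) → ℕ
zeroCount x xb = countT (λ j → not (x j) ∧ not (xb j))

InIbar : {n : ℕ} → (Fin n → Bool) → (Fin n → Bool) → Fin n → Set
InIbar x xb i = (xb (unshift i 1) ≡ false) × (x i ≡ false) × (xb (shift i 1) ≡ false)

pattern9 : Vec Bool 9
pattern9 = true ∷ false ∷ false ∷ true ∷ false ∷ true ∷ false ∷ false ∷ true ∷ []

PatternAt : {n : ℕ} → (Fin n → Bool) → (Fin n → Bool) → Fin n → Set
PatternAt x xb s = (m : Fin 9) →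
  (xb (shift s (toℕ m)) ≡ lookup pattern9 m) × (x (shift s (toℕ m)) ≡ lookup pattern9 m)

module Submission where

-- Look at the window v_{i-7}, …, v_{i+8} from both ends. The hypotheses force both rows to read 1 0 0 1 on
-- i-1, …, i+2. Walking outwards, each further value is either forced by the identifying property or, when it
-- deviates from 1 0 0 1 0 1 0 0 1, admits a local exchange (one code vertex moves onto a position empty in both
-- rows) giving an identifying code of the same size with fewer empty positions. If neither flank completes the
-- pattern, the double exchange v̄_{i-1}, v̄_{i+2} ↦ v̄_i, v̄_{i+1} does the same.

open import Defs
open import Data.Nat using (ℕ; zero; suc; _+_; _∸_; _≤_; _<_; z≤n; s≤s; _%_; _<ᵇ_; _≤ᵇ_)
open import Data.Nat.Properties
  using ( ≤-reflexive; ≤-trans; <-≤-trans; ≤-<-trans; <-irrefl; <⇒≤; <⇒≢; ≮⇒≥; _<?_; n≤1+n; ≤-pred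
        ; +-comm; +-assoc; +-suc; +-identityʳ; +-cancelˡ-≡; +-cancelʳ-<; +-monoʳ-<; m≤m+n
        ; +-∸-assoc; m∸n+n≡m; m∸n≤m; m∸[m∸n]≡n; m+[n∸m]≡n; m<n⇒0<n∸m; m<n+o⇒m∸n<o; <ᵇ⇒<; ≤ᵇ⇒≤; ≤⇒≤ᵇ)
open import Data.Nat.DivMod using (%-distribˡ-+; m%n%n≡m%n; [m+n]%n≡m%n; m<n⇒m%n≡m; m%n≤m; m≤n⇒[n∸m]%m≡n%m)
open import Data.Fin using (Fin; toℕ; opposite) renaming (zero to fzero; suc to fsuc)
open import Data.Fin.Properties using (_≟_; suc-injective; toℕ-fromℕ<; toℕ-injective; toℕ<n; opposite-prop)
open import Data.Bool using (Bool; true; false; if_then_else_; not; _∧_; T)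
open import Data.Bool.Properties using (¬-not)
open import Data.Sum using (_⊎_; inj₁; inj₂; [_,_]′)
import Data.Sum as Sum
open import Data.Sum.Properties using (inj₁-injective; inj₂-injective)
open import Data.Product using (_×_; _,_; ∃; ∃₂; proj₁; proj₂)
open import Data.Empty using (⊥; ⊥-elim)
open import Data.List using (List; []; _∷_; length)
open import Data.List.Membership.Propositional using (_∉_)
open import Data.List.Relation.Unary.Any using (here; there)
open import Data.Vec using (lookup)
open import Data.Vec.Functional using (updateAt)
open import Data.Vec.Functional.Properties using (updateAt-updates; updateAt-minimal)
open import Function using (_∘_; const)
open import Function.Bundles using (_⇔_; mk⇔; Equivalence)
open import Relation.Nullary using (¬_; Dec; yes; no)
open import Relation.Binary.PropositionalEquality

private
  variable
    n : ℕ

clash : {b : Bool} → b ≡ true → b ≡ false → ⊥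
clash refl ()

update : (Fin n → Bool) → Fin n → Bool → Fin n → Bool
update f p v = updateAt f p (const v)

module _ (f : Fin n → Bool) (p : Fin n) where

  update-≡ : ∀ v → update f p v p ≡ v
  update-≡ v = updateAt-updates p f

  update-≢ : ∀ v {q} → q ≢ p → update f p v q ≡ f q
  update-≢ v {q} = updateAt-minimal q p f

  update-true-mono : ∀ q → f q ≡ true → update f p true q ≡ true
  update-true-mono q fq with q ≟ p
  ... | yes refl = update-≡ true
  ... | no q≢p = trans (update-≢ true q≢p) fq

  update-false-lost : ∀ {q} → f q ≡ true → update f p false q ≡ false → q ≡ p
  update-false-lost {q} fq f'q with q ≟ p
  ... | yes q≡p = q≡p
  ... | no q≢p = ⊥-elim (clash fq (trans (sym (update-≢ false q≢p)) f'q))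

countT-cong : (f g : Fin n → Bool) → (∀ q → f q ≡ g q) → countT f ≡ countT g
countT-cong {zero} f g f≗g = refl
countT-cong {suc n} f g f≗g rewrite f≗g fzero =
  cong ((if g fzero then 1 else 0) +_) (countT-cong (λ j → f (fsuc j)) (λ j → g (fsuc j)) (λ j → f≗g (fsuc j)))

countT-mono : (f g : Fin n → Bool) → (∀ q → f q ≡ true → g q ≡ true) → countT f ≤ countT g
countT-mono {zero} f g f⊆g = z≤n
countT-mono {suc n} f g f⊆g with f fzero in f0 | g fzero in g0
... | true | true = s≤s (countT-mono _ _ (λ q → f⊆g (fsuc q)))
... | true | false = ⊥-elim (clash (f⊆g fzero f0) g0)
... | false | true = ≤-trans (countT-mono _ _ (λ q → f⊆g (fsuc q))) (n≤1+n _)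
... | false | false = countT-mono _ _ (λ q → f⊆g (fsuc q))

countT-differAt : (f g : Fin n → Bool) (p : Fin n) → (∀ q → q ≢ p → f q ≡ g q) →
                  f p ≡ true → g p ≡ false → countT f ≡ suc (countT g)
countT-differAt {suc n} f g fzero f≗g fp gp rewrite fp | gp =
  cong suc (countT-cong _ _ (λ j → f≗g (fsuc j) (λ ())))
countT-differAt {suc n} f g (fsuc p) f≗g fp gp rewrite f≗g fzero (λ ()) =
  trans (cong ((if g fzero then 1 else 0) +_)
          (countT-differAt (λ j → f (fsuc j)) (λ j → g (fsuc j)) p
             (λ q q≢p → f≗g (fsuc q) (λ e → q≢p (suc-injective e))) fp gp))
        (+-suc (if g fzero then 1 else 0) _)

countT-update-true : (f : Fin n → Bool) (p : Fin n) → f p ≡ false → countT (update f p true) ≡ suc (countT f)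
countT-update-true f p fp =
  countT-differAt (update f p true) f p (λ q → update-≢ f p true) (update-≡ f p true) fp

countT-update-false : (f : Fin n → Bool) (p : Fin n) → f p ≡ true → countT f ≡ suc (countT (update f p false))
countT-update-false f p fp =
  countT-differAt f (update f p false) p (λ q q≢p → sym (update-≢ f p false q≢p)) fp (update-≡ f p false)

countT-update-false-≤ : (f : Fin n → Bool) (p : Fin n) → countT f ≤ suc (countT (update f p false))
countT-update-false-≤ f p with f p in fp
... | true = ≤-reflexive (countT-update-false f p fp)
... | false = ≤-trans (≤-reflexive (countT-cong f (update f p false) unchanged)) (n≤1+n _)
  where
  unchanged : ∀ q → f q ≡ update f p false q
  unchanged q with q ≟ p
  ... | yes refl = trans fp (sym (update-≡ f p false))
  ... | no q≢p = sym (update-≢ f p false q≢p)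

countT-< : (f g : Fin n → Bool) (p : Fin n) → (∀ q → g q ≡ true → f q ≡ true) →
           f p ≡ true → g p ≡ false → countT g < countT f
countT-< f g p g⊆f fp gp = subst (countT g <_) (sym (countT-update-false f p fp))
  (s≤s (countT-mono g (update f p false) g⊆f-p))
  where
  g⊆f-p : ∀ q → g q ≡ true → update f p false q ≡ true
  g⊆f-p q gq = trans (update-≢ f p false (λ { refl → clash gq gp })) (g⊆f q gq)

∃-true-∉ : (f : Fin n → Bool) (L : List (Fin n)) → length L < countT f → ∃ λ t → f t ≡ true × t ∉ L
∃-true-∉ {zero} f [] ()
∃-true-∉ {suc n} f [] L<f with f fzero in f0
... | true = fzero , f0 , λ ()
... | false with ∃-true-∉ (λ j → f (fsuc j)) [] L<f
... | t , ft , _ = fsuc t , ft , λ ()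
∃-true-∉ f (a ∷ L) L<f with ∃-true-∉ (update f a false) L (≤-pred (≤-trans L<f (countT-update-false-≤ f a)))
... | t , f't , t∉L = t , trans (sym (update-≢ f a false t≢a)) f't , λ { (here t≡a) → t≢a t≡a ; (there t∈L) → t∉L t∈L }
  where
  t≢a : t ≢ a
  t≢a refl = clash f't (update-≡ f a false)

BothFalse : (Fin n → Bool) → (Fin n → Bool) → Fin n → Set
BothFalse x xb q = x q ≡ false × xb q ≡ false

zeroCount-< : (x xb x' xb' : Fin n → Bool) (p : Fin n) →
              (∀ q → BothFalse x' xb' q → BothFalse x xb q) →
              BothFalse x xb p → ¬ BothFalse x' xb' p →
              zeroCount x' xb' < zeroCount x xb
zeroCount-< x xb x' xb' p new⊆old (xp , xbp) p-filled =
  countT-< (λ j → not (x j) ∧ not (xb j)) (λ j → not (x' j) ∧ not (xb' j)) p mono old-p new-p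
  where
  bothFalse⇔ : ∀ (a b : Bool) → not a ∧ not b ≡ true → a ≡ false × b ≡ false
  bothFalse⇔ false false _ = refl , refl
  mono : ∀ q → not (x' q) ∧ not (xb' q) ≡ true → not (x q) ∧ not (xb q) ≡ true
  mono q e with new⊆old q (bothFalse⇔ (x' q) (xb' q) e)
  ... | xq , xbq rewrite xq | xbq = refl
  old-p : not (x p) ∧ not (xb p) ≡ true
  old-p rewrite xp | xbp = refl
  new-p : not (x' p) ∧ not (xb' p) ≡ false
  new-p = ¬-not λ e → p-filled (bothFalse⇔ (x' p) (xb' p) e)

module Traces (G : Graph) where

  SameTrace : (V G → Bool) → V G → V G → Set
  SameTrace D u w = ∀ z → (D z ≡ true × ClosedNbhd G u z) ⇔ (D z ≡ true × ClosedNbhd G w z)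

  SameTrace-sym : ∀ {D u w} → SameTrace D u w → SameTrace D w u
  SameTrace-sym same z = mk⇔ (Equivalence.from (same z)) (Equivalence.to (same z))

  SameTrace-transfer : ∀ {D u w} → SameTrace D u w → ∀ {z} → D z ≡ true → ClosedNbhd G u z → ClosedNbhd G w z
  SameTrace-transfer same {z} Dz uz = proj₂ (Equivalence.to (same z) (Dz , uz))

  Covers : (V G → Bool) → V G → Set
  Covers D z = ∀ u → ClosedNbhd G u z → ∃ λ z' → D z' ≡ true × ClosedNbhd G u z'

  Detects : (V G → Bool) → V G → Set
  Detects D z = ∀ u w → SameTrace D u w → ClosedNbhd G u z → ClosedNbhd G w z

  -- The D-trace of a vertex is determined by its D'-trace: the vertices kept in D' are read off directly and the
  -- removed ones are detected, so distinct D-traces stay distinct.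
  identifying-exchange : (D D' : V G → Bool) → IsIdentifyingCode G D →
    (∀ z → D z ≡ true → D' z ≡ false → Covers D' z × Detects D' z) →
    IsIdentifyingCode G D'
  identifying-exchange D D' (dominating , separating) lost = dominating' , separating'
    where
    dominating' : ∀ u → ∃ λ z → D' z ≡ true × ClosedNbhd G u z
    dominating' u with dominating u
    ... | z , Dz , uz with D' z in D'z
    ... | true = z , D'z , uz
    ... | false = proj₁ (lost z Dz D'z) u uz
    transfer : ∀ u w → SameTrace D' u w → ∀ z → D z ≡ true × ClosedNbhd G u z → D z ≡ true × ClosedNbhd G w z
    transfer u w same z (Dz , uz) with D' z in D'z
    ... | true = Dz , SameTrace-transfer same D'z uz
    ... | false = Dz , proj₂ (lost z Dz D'z) u w same uz
    separating' : ∀ u w → u ≢ w → ¬ SameTrace D' u w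
    separating' u w u≢w same = separating u w u≢w λ z →
      mk⇔ (transfer u w same z) (transfer w u (SameTrace-sym same) z)

module Cycle (m : ℕ) where

  N : ℕ
  N = suc m

  toℕ-shift : ∀ (q : Fin N) d → toℕ (shift q d) ≡ (toℕ q + d) % N
  toℕ-shift q d = toℕ-fromℕ< _

  shift-shift : ∀ (q : Fin N) a b → shift (shift q a) b ≡ shift q (a + b)
  shift-shift q a b = toℕ-injective (begin
      toℕ (shift (shift q a) b)       ≡⟨ toℕ-shift (shift q a) b ⟩
      (toℕ (shift q a) + b) % N       ≡⟨ cong (λ y → (y + b) % N) (toℕ-shift q a) ⟩
      ((toℕ q + a) % N + b) % N       ≡⟨ %-distribˡ-+ ((toℕ q + a) % N) b N ⟩
      ((toℕ q + a) % N % N + b % N) % N ≡⟨ cong (λ y → (y + b % N) % N) (m%n%n≡m%n (toℕ q + a) N) ⟩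
      ((toℕ q + a) % N + b % N) % N   ≡⟨ sym (%-distribˡ-+ (toℕ q + a) b N) ⟩
      (toℕ q + a + b) % N             ≡⟨ cong (_% N) (+-assoc (toℕ q) a b) ⟩
      (toℕ q + (a + b)) % N           ≡⟨ sym (toℕ-shift q (a + b)) ⟩
      toℕ (shift q (a + b))           ∎)
    where open ≡-Reasoning

  shift-0 : ∀ (q : Fin N) → shift q 0 ≡ q
  shift-0 q = toℕ-injective (begin
      toℕ (shift q 0)    ≡⟨ toℕ-shift q 0 ⟩
      (toℕ q + 0) % N    ≡⟨ cong (_% N) (+-identityʳ (toℕ q)) ⟩
      toℕ q % N          ≡⟨ m<n⇒m%n≡m (toℕ<n q) ⟩
      toℕ q              ∎)
    where open ≡-Reasoning

  shift-N : ∀ (q : Fin N) → shift q N ≡ q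
  shift-N q = toℕ-injective (begin
      toℕ (shift q N)    ≡⟨ toℕ-shift q N ⟩
      (toℕ q + N) % N    ≡⟨ [m+n]%n≡m%n (toℕ q) N ⟩
      toℕ q % N          ≡⟨ m<n⇒m%n≡m (toℕ<n q) ⟩
      toℕ q              ∎)
    where open ≡-Reasoning

  shift-≢ : ∀ (q : Fin N) d → 0 < d → d < N → shift q d ≢ q
  shift-≢ q d 0<d d<N q+d≡q with toℕ q + d <? N
  ... | yes q+d<N = <⇒≢ 0<d (sym (+-cancelˡ-≡ (toℕ q) d 0 (begin
      toℕ q + d          ≡⟨ sym (m<n⇒m%n≡m q+d<N) ⟩
      (toℕ q + d) % N    ≡⟨ q+d%N≡q ⟩
      toℕ q              ≡⟨ sym (+-identityʳ (toℕ q)) ⟩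
      toℕ q + 0          ∎)))
    where
    open ≡-Reasoning
    q+d%N≡q : (toℕ q + d) % N ≡ toℕ q
    q+d%N≡q = trans (sym (toℕ-shift q d)) (cong toℕ q+d≡q)
  ... | no q+d≮N = <-irrefl wrapped (≤-<-trans (m%n≤m (toℕ q + d ∸ N) N) wrapped<q)
    where
    N≤q+d : N ≤ toℕ q + d
    N≤q+d = ≮⇒≥ q+d≮N
    wrapped : (toℕ q + d ∸ N) % N ≡ toℕ q
    wrapped = trans (m≤n⇒[n∸m]%m≡n%m N≤q+d) (trans (sym (toℕ-shift q d)) (cong toℕ q+d≡q))
    wrapped<q : toℕ q + d ∸ N < toℕ q
    wrapped<q = +-cancelʳ-< N _ (toℕ q)
      (subst (_< toℕ q + N) (sym (m∸n+n≡m N≤q+d)) (+-monoʳ-< (toℕ q) d<N))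

  next prev : Fin N → Fin N
  next q = shift q 1
  prev q = unshift q 1

  next-prev : ∀ q → next (prev q) ≡ q
  next-prev q = trans (shift-shift q m 1) (trans (cong (shift q) (+-comm m 1)) (shift-N q))

  prev-next : ∀ q → prev (next q) ≡ q
  prev-next q = trans (shift-shift q 1 m) (shift-N q)

  next-injective : ∀ {a b} → next a ≡ next b → a ≡ b
  next-injective {a} {b} e = trans (sym (prev-next a)) (trans (cong prev e) (prev-next b))

  adjacent-sym : ∀ {a b} → CycleAdj N a b → CycleAdj N b a
  adjacent-sym (inj₁ e) = inj₂ e
  adjacent-sym (inj₂ e) = inj₁ e

AvoidsAnyThree : {n : ℕ} → (Fin n → Bool) → Set
AvoidsAnyThree g = ∀ a b c → ∃ λ t → g t ≡ true × t ∉ a ∷ b ∷ c ∷ []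

avoidsAnyThree : {n : ℕ} (f g : Fin n → Bool) (R : List (Fin n)) → 3 + length R < countT f →
                 (∀ t → f t ≡ true → t ∉ R → g t ≡ true) → AvoidsAnyThree g
avoidsAnyThree f g R big f⊆g a b c with ∃-true-∉ f (a ∷ b ∷ c ∷ R) big
... | t , ft , t∉ = t , f⊆g t ft (λ t∈R → t∉ (there (there (there t∈R)))) ,
                        λ { (here e) → t∉ (here e) ; (there (here e)) → t∉ (there (here e))
                          ; (there (there (here e))) → t∉ (there (there (here e))) ; (there (there (there ()))) }

pattern9-palindrome : ∀ k → lookup pattern9 (opposite k) ≡ lookup pattern9 k
pattern9-palindrome fzero = refl
pattern9-palindrome (fsuc fzero) = refl
pattern9-palindrome (fsuc (fsuc fzero)) = refl
pattern9-palindrome (fsuc (fsuc (fsuc fzero))) = refl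
pattern9-palindrome (fsuc (fsuc (fsuc (fsuc fzero)))) = refl
pattern9-palindrome (fsuc (fsuc (fsuc (fsuc (fsuc fzero))))) = refl
pattern9-palindrome (fsuc (fsuc (fsuc (fsuc (fsuc (fsuc fzero)))))) = refl
pattern9-palindrome (fsuc (fsuc (fsuc (fsuc (fsuc (fsuc (fsuc fzero))))))) = refl
pattern9-palindrome (fsuc (fsuc (fsuc (fsuc (fsuc (fsuc (fsuc (fsuc fzero)))))))) = refl

module Prism (m : ℕ) (9≤N : 9 ≤ suc m) where
  open Cycle m public

  G : Graph
  G = CnBar N

  open Traces G public

  Vertex : Set
  Vertex = Fin N ⊎ Fin N

  N[_]∋_ : Vertex → Vertex → Set
  N[ u ]∋ z = ClosedNbhd G u z

  N[]∋self : ∀ u → N[ u ]∋ u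
  N[]∋self u = inj₁ refl

  N[v]∋v̄ : ∀ q → N[ inj₁ q ]∋ inj₂ q
  N[v]∋v̄ q = inj₂ refl

  N[v̄]∋v : ∀ q → N[ inj₂ q ]∋ inj₁ q
  N[v̄]∋v q = inj₂ refl

  N[v]∋v̄⇒≡ : ∀ {q p} → N[ inj₁ q ]∋ inj₂ p → q ≡ p
  N[v]∋v̄⇒≡ (inj₂ q≡p) = q≡p

  N[v̄]∋v⇒≡ : ∀ {q p} → N[ inj₂ q ]∋ inj₁ p → q ≡ p
  N[v̄]∋v⇒≡ (inj₂ q≡p) = q≡p

  N-sym : ∀ {u z} → N[ u ]∋ z → N[ z ]∋ u
  N-sym (inj₁ e) = inj₁ (sym e)
  N-sym {inj₁ i} {inj₁ j} (inj₂ a) = inj₂ (adjacent-sym a)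
  N-sym {inj₁ i} {inj₂ j} (inj₂ e) = inj₂ (sym e)
  N-sym {inj₂ i} {inj₁ j} (inj₂ e) = inj₂ (sym e)
  N-sym {inj₂ i} {inj₂ j} (inj₂ (i≢j , ¬a)) = inj₂ ((λ e → i≢j (sym e)) , λ a → ¬a (adjacent-sym a))

  adjacent-irreflexive : ∀ q → ¬ CycleAdj N q q
  adjacent-irreflexive q = shift-≢ q 1 (s≤s z≤n) (≤-trans (m≤m+n 2 7) 9≤N) ∘ Sum.reduce

  adjacent? : ∀ a b → Dec (CycleAdj N a b)
  adjacent? a b with next a ≟ b | next b ≟ a
  ... | yes e | _ = yes (inj₁ e)
  ... | no _ | yes e = yes (inj₂ e)
  ... | no ¬e₁ | no ¬e₂ = no λ { (inj₁ e) → ¬e₁ e ; (inj₂ e) → ¬e₂ e }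

  N[v̄]∌adjacent : ∀ {k p} → CycleAdj N k p → ¬ N[ inj₂ k ]∋ inj₂ p
  N[v̄]∌adjacent {k} a (inj₁ refl) = adjacent-irreflexive k a
  N[v̄]∌adjacent a (inj₂ (_ , ¬a)) = ¬a a

  N[v̄]∌⇒adjacent : ∀ k p → ¬ N[ inj₂ k ]∋ inj₂ p → CycleAdj N k p
  N[v̄]∌⇒adjacent k p ∌ with adjacent? k p | k ≟ p
  ... | yes a | _ = a
  ... | no _ | yes refl = ⊥-elim (∌ (inj₁ refl))
  ... | no ¬a | no k≢p = ⊥-elim (∌ (inj₂ (k≢p , ¬a)))

  N[v̄]∋v̄ : ∀ k t → t ≢ next k → t ≢ prev k → N[ inj₂ k ]∋ inj₂ t
  N[v̄]∋v̄ k t t≢next t≢prev with t ≟ k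
  ... | yes refl = inj₁ refl
  ... | no t≢k = inj₂ ((λ e → t≢k (sym e)) ,
                       λ { (inj₁ e) → t≢next (sym e) ; (inj₂ e) → t≢prev (trans (sym (prev-next t)) (cong prev e)) })

  module _ (x xb : Fin N → Bool) (spread : AvoidsAnyThree xb) where

    v≁v̄ : ∀ j k → ¬ SameTrace (codeOf x xb) (inj₁ j) (inj₂ k)
    v≁v̄ j k same with spread j (next k) (prev k)
    ... | t , xbt , t∉ = t∉ (here (sym (N[v]∋v̄⇒≡ (proj₂ (Equivalence.from (same (inj₂ t))
                            (xbt , N[v̄]∋v̄ k t (λ e → t∉ (there (here e))) (λ e → t∉ (there (there (here e))))))))))

    v̄≁v : ∀ j k → ¬ SameTrace (codeOf x xb) (inj₂ k) (inj₁ j)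
    v̄≁v j k same = v≁v̄ j k (SameTrace-sym same)

    v̄-dominated : ∀ k → ∃ λ z → codeOf x xb z ≡ true × N[ inj₂ k ]∋ z
    v̄-dominated k with spread (next k) (prev k) k
    ... | t , xbt , t∉ = inj₂ t , xbt , N[v̄]∋v̄ k t (λ e → t∉ (here e)) (λ e → t∉ (there (here e)))

  Improvable : (Fin N → Bool) → (Fin N → Bool) → Set
  Improvable x xb = ∃₂ λ (x' xb' : Fin N → Bool) →
    IsIdentifyingCode G (codeOf x' xb') × codeSize x' xb' ≤ codeSize x xb × zeroCount x' xb' < zeroCount x xb

  module MoveToBar (x xb : Fin N → Bool) (p q : Fin N) where
    x' xb' : Fin N → Bool
    x' = update x p false
    xb' = update xb q true

    D' : Vertex → Bool
    D' = codeOf x' xb'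

    spread : 4 ≤ countT xb → AvoidsAnyThree xb'
    spread 4≤ = avoidsAnyThree xb xb' [] 4≤ (λ t xbt _ → update-true-mono xb q t xbt)

    improvable : IsIdentifyingCode G (codeOf x xb) → x p ≡ true → xb p ≡ true → BothFalse x xb q →
                 Covers D' (inj₁ p) → Detects D' (inj₁ p) → Improvable x xb
    improvable code xp xbp (xq , xbq) covers detects = x' , xb' , code' , size , zeros
      where
      lost : ∀ z → codeOf x xb z ≡ true → D' z ≡ false → Covers D' z × Detects D' z
      lost (inj₁ r) xr x'r with update-false-lost x p xr x'r
      ... | refl = covers , detects
      lost (inj₂ r) xbr xb'r = ⊥-elim (clash (update-true-mono xb q r xbr) xb'r)
      code' : IsIdentifyingCode G D'
      code' = identifying-exchange (codeOf x xb) D' code lost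
      size : codeSize x' xb' ≤ codeSize x xb
      size rewrite countT-update-false x p xp | countT-update-true xb q xbq =
        ≤-reflexive (+-suc (countT x') (countT xb))
      no-new-zero : ∀ r → BothFalse x' xb' r → BothFalse x xb r
      no-new-zero r (x'r , xb'r) with r ≟ p
      ... | yes refl = ⊥-elim (clash (update-true-mono xb q p xbp) xb'r)
      ... | no r≢p = trans (sym (update-≢ x p false r≢p)) x'r , ¬-not λ xbr → clash (update-true-mono xb q r xbr) xb'r
      zeros : zeroCount x' xb' < zeroCount x xb
      zeros = zeroCount-< x xb x' xb' q no-new-zero (xq , xbq) λ (_ , xb'q) → clash (update-≡ xb q true) xb'q

  module MoveToCycle (x xb : Fin N → Bool) (p q : Fin N) where
    x' xb' : Fin N → Bool
    x' = update x q true
    xb' = update xb p false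

    D' : Vertex → Bool
    D' = codeOf x' xb'

    spread : 5 ≤ countT xb → AvoidsAnyThree xb'
    spread 5≤ = avoidsAnyThree xb xb' (p ∷ []) 5≤ λ t xbt t∉ → trans (update-≢ xb p false (λ e → t∉ (here e))) xbt

    improvable : IsIdentifyingCode G (codeOf x xb) → 5 ≤ countT xb → x p ≡ true → xb p ≡ true → BothFalse x xb q →
                 Detects D' (inj₂ p) → Improvable x xb
    improvable code 5≤ xp xbp (xq , xbq) detects = x' , xb' , code' , size , zeros
      where
      covers : Covers D' (inj₂ p)
      covers (inj₁ r) N[r]∋p with N[v]∋v̄⇒≡ N[r]∋p
      ... | refl = inj₁ r , update-true-mono x q r xp , N[]∋self _
      covers (inj₂ k) _ = v̄-dominated x' xb' (spread 5≤) k
      lost : ∀ z → codeOf x xb z ≡ true → D' z ≡ false → Covers D' z × Detects D' z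
      lost (inj₁ r) xr x'r = ⊥-elim (clash (update-true-mono x q r xr) x'r)
      lost (inj₂ r) xbr xb'r with update-false-lost xb p xbr xb'r
      ... | refl = covers , detects
      code' : IsIdentifyingCode G D'
      code' = identifying-exchange (codeOf x xb) D' code lost
      size : codeSize x' xb' ≤ codeSize x xb
      size rewrite countT-update-true x q xq | countT-update-false xb p xbp =
        ≤-reflexive (sym (+-suc (countT x) (countT xb')))
      no-new-zero : ∀ r → BothFalse x' xb' r → BothFalse x xb r
      no-new-zero r (x'r , xb'r) with r ≟ p
      ... | yes refl = ⊥-elim (clash (update-true-mono x q p xp) x'r)
      ... | no r≢p = ¬-not (λ xr → clash (update-true-mono x q r xr) x'r) , trans (sym (update-≢ xb p false r≢p)) xb'r
      zeros : zeroCount x' xb' < zeroCount x xb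
      zeros = zeroCount-< x xb x' xb' q no-new-zero (xq , xbq) λ (x'q , _) → clash (update-≡ x q true) x'q

  -- A walk along the cycle in either direction: each local lemma is proved once and used on both sides of i.
  record Traversal : Set where
    field
      W : ℕ → Fin N
      step : ∀ e → CycleAdj N (W e) (W (suc e))
      neighbours : ∀ e q → CycleAdj N q (W (suc e)) → q ≡ W e ⊎ q ≡ W (suc (suc e))
      distinct : ∀ a d → 0 < d → d < 9 → W a ≢ W (a + d)

  forwardFrom : Fin N → ℕ → Fin N
  forwardFrom b zero = b
  forwardFrom b (suc e) = next (forwardFrom b e)

  forwardFrom-+ : ∀ b a d → forwardFrom b (a + d) ≡ shift (forwardFrom b a) d
  forwardFrom-+ b a zero rewrite +-identityʳ a = sym (shift-0 (forwardFrom b a))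
  forwardFrom-+ b a (suc d) rewrite +-suc a d = begin
      next (forwardFrom b (a + d))       ≡⟨ cong next (forwardFrom-+ b a d) ⟩
      shift (shift (forwardFrom b a) d) 1 ≡⟨ shift-shift (forwardFrom b a) d 1 ⟩
      shift (forwardFrom b a) (d + 1)    ≡⟨ cong (shift (forwardFrom b a)) (+-comm d 1) ⟩
      shift (forwardFrom b a) (suc d)    ∎
    where open ≡-Reasoning

  forward : Fin N → Traversal
  forward b = record
    { W = forwardFrom b
    ; step = λ e → inj₁ refl
    ; neighbours = λ e q → λ { (inj₁ eq) → inj₁ (next-injective eq) ; (inj₂ eq) → inj₂ (sym eq) }
    ; distinct = λ a d 0<d d<9 e → shift-≢ (forwardFrom b a) d 0<d (<-≤-trans d<9 9≤N)
                                     (sym (trans e (forwardFrom-+ b a d)))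
    }

  backwardFrom : Fin N → ℕ → Fin N
  backwardFrom c zero = c
  backwardFrom c (suc e) = prev (backwardFrom c e)

  shift-backwardFrom : ∀ c a d → shift (backwardFrom c (a + d)) d ≡ backwardFrom c a
  shift-backwardFrom c a zero rewrite +-identityʳ a = shift-0 (backwardFrom c a)
  shift-backwardFrom c a (suc d) rewrite +-suc a d = begin
      shift (prev (backwardFrom c (a + d))) (suc d)    ≡⟨ sym (shift-shift (prev (backwardFrom c (a + d))) 1 d) ⟩
      shift (next (prev (backwardFrom c (a + d)))) d   ≡⟨ cong (λ y → shift y d) (next-prev (backwardFrom c (a + d))) ⟩
      shift (backwardFrom c (a + d)) d                 ≡⟨ shift-backwardFrom c a d ⟩
      backwardFrom c a                                 ∎
    where open ≡-Reasoning

  backward : Fin N → Traversal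
  backward c = record
    { W = backwardFrom c
    ; step = λ e → inj₂ (next-prev (backwardFrom c e))
    ; neighbours = λ e q → λ { (inj₁ eq) → inj₂ (trans (sym (prev-next q)) (cong prev eq))
                              ; (inj₂ eq) → inj₁ (sym (trans (sym (next-prev (backwardFrom c e))) eq)) }
    ; distinct = λ a d 0<d d<9 e → shift-≢ (backwardFrom c a) d 0<d (<-≤-trans d<9 9≤N)
                                     (trans (cong (λ y → shift y d) e) (shift-backwardFrom c a d))
    }

  backward-forward : ∀ b e → e ≤ 15 → backwardFrom (forwardFrom b 15) e ≡ forwardFrom b (15 ∸ e)
  backward-forward b zero _ = refl
  backward-forward b (suc e) e<15 = begin
      prev (backwardFrom (forwardFrom b 15) e)  ≡⟨ cong prev (backward-forward b e (≤-trans (n≤1+n e) e<15)) ⟩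
      prev (forwardFrom b (15 ∸ e))             ≡⟨ cong (λ k → prev (forwardFrom b k)) (+-∸-assoc 1 {14} {e} (≤-pred e<15)) ⟩
      prev (next (forwardFrom b (15 ∸ suc e)))  ≡⟨ prev-next _ ⟩
      forwardFrom b (15 ∸ suc e)                ∎
    where open ≡-Reasoning

  module Along (w : Traversal) where
    open Traversal w public

    W-≢ : ∀ a c → {T (a <ᵇ c)} → {T (c <ᵇ a + 9)} → W a ≢ W c
    W-≢ a c {a<c} {c<a+9} e = distinct a (c ∸ a) (m<n⇒0<n∸m a<c') (m<n+o⇒m∸n<o c a (<ᵇ⇒< c (a + 9) c<a+9))
                                (trans e (cong W (sym (m+[n∸m]≡n (<⇒≤ a<c')))))
      where
      a<c' = <ᵇ⇒< a c a<c

    W-≢' : ∀ a c → {T (a <ᵇ c)} → {T (c <ᵇ a + 9)} → W c ≢ W a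
    W-≢' a c {a<c} {c<a+9} e = W-≢ a c {a<c} {c<a+9} (sym e)

    N[vW]∋vW-succ : ∀ e → N[ inj₁ (W e) ]∋ inj₁ (W (suc e))
    N[vW]∋vW-succ e = inj₂ (step e)

    N[vW]∋vW-pred : ∀ e → N[ inj₁ (W (suc e)) ]∋ inj₁ (W e)
    N[vW]∋vW-pred e = inj₂ (adjacent-sym (step e))

    N[v]∋vW⇒ : ∀ e q → N[ inj₁ q ]∋ inj₁ (W (suc e)) → q ≡ W e ⊎ q ≡ W (suc e) ⊎ q ≡ W (suc (suc e))
    N[v]∋vW⇒ e q (inj₁ refl) = inj₂ (inj₁ refl)
    N[v]∋vW⇒ e q (inj₂ a) with neighbours e q a
    ... | inj₁ e = inj₁ e
    ... | inj₂ e = inj₂ (inj₂ e)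

    N[vW]∌vW : ∀ e a → W a ≢ W e → W a ≢ W (suc e) → W a ≢ W (suc (suc e)) → ¬ N[ inj₁ (W a) ]∋ inj₁ (W (suc e))
    N[vW]∌vW e a ≢₀ ≢₁ ≢₂ ∋ with N[v]∋vW⇒ e (W a) ∋
    ... | inj₁ e = ≢₀ e
    ... | inj₂ (inj₁ e) = ≢₁ e
    ... | inj₂ (inj₂ e) = ≢₂ e

    N[v̄]∌v̄W⇒ : ∀ e q → ¬ N[ inj₂ q ]∋ inj₂ (W (suc e)) → q ≡ W e ⊎ q ≡ W (suc (suc e))
    N[v̄]∌v̄W⇒ e q ∌ = neighbours e q (N[v̄]∌⇒adjacent q (W (suc e)) ∌)

    N[v̄W]∋v̄ : ∀ e q → q ≢ W e → q ≢ W (suc (suc e)) → N[ inj₂ (W (suc e)) ]∋ inj₂ q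
    N[v̄W]∋v̄ e q ≢₀ ≢₂ with q ≟ W (suc e)
    ... | yes refl = inj₁ refl
    ... | no ≢₁ = inj₂ ((λ e → ≢₁ (sym e)) , λ a → [ ≢₀ , ≢₂ ]′ (neighbours e q (adjacent-sym a)))

  module Around (w : Traversal) (x xb : Fin N → Bool) (code : IsIdentifyingCode G (codeOf x xb)) (6≤ : 6 ≤ countT xb) where
    open Along w public

    D : Vertex → Bool
    D = codeOf x xb

    v-dominated : ∀ e → x (W e) ≡ true ⊎ x (W (suc e)) ≡ true ⊎ x (W (suc (suc e))) ≡ true ⊎ xb (W (suc e)) ≡ true
    v-dominated e with proj₁ code (inj₁ (W (suc e)))
    ... | inj₁ q , Dq , ∋q with N[v]∋vW⇒ e q (N-sym ∋q)
    ...   | inj₁ refl = inj₁ Dq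
    ...   | inj₂ (inj₁ refl) = inj₂ (inj₁ Dq)
    ...   | inj₂ (inj₂ refl) = inj₂ (inj₂ (inj₁ Dq))
    v-dominated e | inj₂ q , Dq , ∋q with N[v]∋v̄⇒≡ ∋q
    ... | refl = inj₂ (inj₂ (inj₂ Dq))

    x-before-forced : ∀ e → x (W (suc e)) ≡ false → x (W (suc (suc e))) ≡ false → xb (W (suc e)) ≡ false → x (W e) ≡ true
    x-before-forced e x₁ x₂ x̄₁ with v-dominated e
    ... | inj₁ x₀ = x₀
    ... | inj₂ (inj₁ x₁') = ⊥-elim (clash x₁' x₁)
    ... | inj₂ (inj₂ (inj₁ x₂')) = ⊥-elim (clash x₂' x₂)
    ... | inj₂ (inj₂ (inj₂ x̄₁')) = ⊥-elim (clash x̄₁' x̄₁)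

    x-after-forced : ∀ e → x (W e) ≡ false → x (W (suc e)) ≡ false → xb (W (suc e)) ≡ false → x (W (suc (suc e))) ≡ true
    x-after-forced e x₀ x₁ x̄₁ with v-dominated e
    ... | inj₁ x₀' = ⊥-elim (clash x₀' x₀)
    ... | inj₂ (inj₁ x₁') = ⊥-elim (clash x₁' x₁)
    ... | inj₂ (inj₂ (inj₁ x₂)) = x₂
    ... | inj₂ (inj₂ (inj₂ x̄₁')) = ⊥-elim (clash x̄₁' x̄₁)

    x̄-forced : ∀ e → x (W e) ≡ false → x (W (suc e)) ≡ false → x (W (suc (suc e))) ≡ false → xb (W (suc e)) ≡ true
    x̄-forced e x₀ x₁ x₂ with v-dominated e
    ... | inj₁ x₀' = ⊥-elim (clash x₀' x₀)
    ... | inj₂ (inj₁ x₁') = ⊥-elim (clash x₁' x₁)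
    ... | inj₂ (inj₂ (inj₁ x₂')) = ⊥-elim (clash x₂' x₂)
    ... | inj₂ (inj₂ (inj₂ x̄₁)) = x̄₁

    x₄-separates-v₅-v₇ : x (W 5) ≡ false → xb (W 5) ≡ false → x (W 7) ≡ false → x (W 8) ≡ false → xb (W 7) ≡ false →
                         x (W 4) ≡ true
    x₄-separates-v₅-v₇ x₅ x̄₅ x₇ x₈ x̄₇ = ¬-not λ x₄ → proj₂ code (inj₁ (W 5)) (inj₁ (W 7)) (W-≢ 5 7 ∘ inj₁-injective)
        λ z → mk⇔ (from-v₅ x₄ z) (from-v₇ x₄ z)
      where
      from-v₅ : x (W 4) ≡ false → ∀ z → D z ≡ true × N[ inj₁ (W 5) ]∋ z → D z ≡ true × N[ inj₁ (W 7) ]∋ z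
      from-v₅ x₄ (inj₁ q) (Dq , ∋q) with N[v]∋vW⇒ 4 q (N-sym ∋q)
      ... | inj₁ refl = ⊥-elim (clash Dq x₄)
      ... | inj₂ (inj₁ refl) = ⊥-elim (clash Dq x₅)
      ... | inj₂ (inj₂ refl) = Dq , N[vW]∋vW-pred 6
      from-v₅ x₄ (inj₂ q) (Dq , ∋q) with N[v]∋v̄⇒≡ ∋q
      ... | refl = ⊥-elim (clash Dq x̄₅)
      from-v₇ : x (W 4) ≡ false → ∀ z → D z ≡ true × N[ inj₁ (W 7) ]∋ z → D z ≡ true × N[ inj₁ (W 5) ]∋ z
      from-v₇ x₄ (inj₁ q) (Dq , ∋q) with N[v]∋vW⇒ 6 q (N-sym ∋q)
      ... | inj₁ refl = Dq , N[vW]∋vW-succ 5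
      ... | inj₂ (inj₁ refl) = ⊥-elim (clash Dq x₇)
      ... | inj₂ (inj₂ refl) = ⊥-elim (clash Dq x₈)
      from-v₇ x₄ (inj₂ q) (Dq , ∋q) with N[v]∋v̄⇒≡ ∋q
      ... | refl = ⊥-elim (clash Dq x̄₇)

    x̄₄-separates-v̄₅-v̄₇ : x (W 5) ≡ false → x (W 7) ≡ false → xb (W 8) ≡ false → xb (W 4) ≡ true
    x̄₄-separates-v̄₅-v̄₇ x₅ x₇ x̄₈ = ¬-not λ x̄₄ → proj₂ code (inj₂ (W 5)) (inj₂ (W 7)) (W-≢ 5 7 ∘ inj₂-injective)
        λ z → mk⇔ (from-v̄₅ x̄₄ z) (from-v̄₇ x̄₄ z)
      where
      from-v̄₅ : xb (W 4) ≡ false → ∀ z → D z ≡ true × N[ inj₂ (W 5) ]∋ z → D z ≡ true × N[ inj₂ (W 7) ]∋ z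
      from-v̄₅ x̄₄ (inj₁ q) (Dq , ∋q) with N[v̄]∋v⇒≡ ∋q
      ... | refl = ⊥-elim (clash Dq x₅)
      from-v̄₅ x̄₄ (inj₂ q) (Dq , ∋q) with q ≟ W 6 | q ≟ W 8
      ... | yes refl | _ = ⊥-elim (N[v̄]∌adjacent (step 5) ∋q)
      ... | no _ | yes refl = ⊥-elim (clash Dq x̄₈)
      ... | no ≢₆ | no ≢₈ = Dq , N[v̄W]∋v̄ 6 q ≢₆ ≢₈
      from-v̄₇ : xb (W 4) ≡ false → ∀ z → D z ≡ true × N[ inj₂ (W 7) ]∋ z → D z ≡ true × N[ inj₂ (W 5) ]∋ z
      from-v̄₇ x̄₄ (inj₁ q) (Dq , ∋q) with N[v̄]∋v⇒≡ ∋q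
      ... | refl = ⊥-elim (clash Dq x₇)
      from-v̄₇ x̄₄ (inj₂ q) (Dq , ∋q) with q ≟ W 4 | q ≟ W 6
      ... | yes refl | _ = ⊥-elim (clash Dq x̄₄)
      ... | no _ | yes refl = ⊥-elim (N[v̄]∌adjacent (adjacent-sym (step 6)) ∋q)
      ... | no ≢₄ | no ≢₆ = Dq , N[v̄W]∋v̄ 4 q ≢₄ ≢₆

    -- Once v₆ leaves the code, v₅ must stay dominated and separated from v₃ and v₄.
    V₆Removable : Set
    V₆Removable = xb (W 5) ≡ true ⊎ (x (W 4) ≡ true × xb (W 4) ≡ true × (x (W 3) ≡ true ⊎ x (W 2) ≡ true ⊎ xb (W 3) ≡ true))

    -- Membership of W (suc e), not W e, in Ī.
    IbarAlong : ℕ → Set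
    IbarAlong e = xb (W e) ≡ false × x (W (suc e)) ≡ false × xb (W (suc (suc e))) ≡ false

    PatternAlong : ℕ → Set
    PatternAlong a = (k : Fin 9) → xb (W (a + toℕ k)) ≡ lookup pattern9 k × x (W (a + toℕ k)) ≡ lookup pattern9 k

    record Flank : Set where
      field
        x₅ : x (W 5) ≡ false
        x̄₅ : xb (W 5) ≡ false
        x₄ : x (W 4) ≡ true
        x̄₄ : xb (W 4) ≡ true
        x₃ : x (W 3) ≡ false
        x₂ : x (W 2) ≡ false
        x̄₃ : xb (W 3) ≡ false
        x̄₁ : xb (W 1) ≡ true

    record Centre : Set where
      field
        x₆ : x (W 6) ≡ true
        x̄₆ : xb (W 6) ≡ true
        x₇ : x (W 7) ≡ false
        x̄₇ : xb (W 7) ≡ false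
        x₈ : x (W 8) ≡ false
        x̄₈ : xb (W 8) ≡ false
        x₉ : x (W 9) ≡ true
        x̄₉ : xb (W 9) ≡ true

    module WithCentre (c : Centre) where
      open Centre c

      move-v₆-to-v̄₇ : V₆Removable → Improvable x xb
      move-v₆-to-v̄₇ v₅-kept = improvable code x₆ x̄₆ (x₇ , x̄₇) covers detects
        where
        open MoveToBar x xb (W 6) (W 7)
        spread' : AvoidsAnyThree xb'
        spread' = spread (≤-trans (m≤m+n 4 2) 6≤)
        x'-kept : ∀ e → W e ≢ W 6 → x' (W e) ≡ x (W e)
        x'-kept e = update-≢ x (W 6) false
        xb'-kept : ∀ e → W e ≢ W 7 → xb' (W e) ≡ xb (W e)
        xb'-kept e = update-≢ xb (W 7) true
        x̄'₆ : xb' (W 6) ≡ true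
        x̄'₆ = trans (xb'-kept 6 (W-≢ 6 7)) x̄₆
        x̄'₇ : xb' (W 7) ≡ true
        x̄'₇ = update-≡ xb (W 7) true
        x̄'₉ : xb' (W 9) ≡ true
        x̄'₉ = trans (xb'-kept 9 (W-≢' 7 9)) x̄₉

        covers : Covers D' (inj₁ (W 6))
        covers (inj₂ p) ∋ with N[v̄]∋v⇒≡ ∋
        ... | refl = inj₂ (W 6) , x̄'₆ , N[]∋self _
        covers (inj₁ p) ∋ with N[v]∋vW⇒ 5 p ∋
        ... | inj₂ (inj₁ refl) = inj₂ (W 6) , x̄'₆ , N[v]∋v̄ _
        ... | inj₂ (inj₂ refl) = inj₂ (W 7) , x̄'₇ , N[v]∋v̄ _
        ... | inj₁ refl = v₅-dominated v₅-kept
          where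
          v₅-dominated : V₆Removable → ∃ λ z → D' z ≡ true × N[ inj₁ (W 5) ]∋ z
          v₅-dominated (inj₁ x̄₅) = inj₂ (W 5) , trans (xb'-kept 5 (W-≢ 5 7)) x̄₅ , N[v]∋v̄ _
          v₅-dominated (inj₂ (x₄ , _)) = inj₁ (W 4) , trans (x'-kept 4 (W-≢ 4 6)) x₄ , N[vW]∋vW-pred 4

        detects-from-v₅ : V₆Removable → ∀ w → SameTrace D' (inj₁ (W 5)) w → N[ w ]∋ inj₁ (W 6)
        detects-from-v₅ _ (inj₂ r) same = ⊥-elim (v≁v̄ x' xb' spread' (W 5) r same)
        detects-from-v₅ (inj₁ x̄₅) (inj₁ r) same with N[v]∋v̄⇒≡ (SameTrace-transfer same (trans (xb'-kept 5 (W-≢ 5 7)) x̄₅) (N[v]∋v̄ (W 5)))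
        ...   | refl = N[vW]∋vW-succ 5
        detects-from-v₅ (inj₂ (x₄ , x̄₄ , v₃-separated)) (inj₁ r) same
            with N[v]∋vW⇒ 3 r (SameTrace-transfer same (trans (x'-kept 4 (W-≢ 4 6)) x₄) (N[vW]∋vW-pred 4))
        ... | inj₂ (inj₂ refl) = N[vW]∋vW-succ 5
        ... | inj₂ (inj₁ refl) = ⊥-elim (W-≢ 4 5 (sym (N[v]∋v̄⇒≡ (SameTrace-transfer (SameTrace-sym same)
                                   (trans (xb'-kept 4 (W-≢ 4 7)) x̄₄) (N[v]∋v̄ (W 4))))))
        ... | inj₁ refl with v₃-separated
        ...   | inj₁ x₃ = ⊥-elim (N[vW]∌vW 2 5 (W-≢' 2 5) (W-≢' 3 5) (W-≢' 4 5)
                            (SameTrace-transfer (SameTrace-sym same) (trans (x'-kept 3 (W-≢ 3 6)) x₃) (N[]∋self _)))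
        ...   | inj₂ (inj₁ x₂) = ⊥-elim (N[vW]∌vW 1 5 (W-≢' 1 5) (W-≢' 2 5) (W-≢' 3 5)
                            (SameTrace-transfer (SameTrace-sym same) (trans (x'-kept 2 (W-≢ 2 6)) x₂) (N[vW]∋vW-pred 2)))
        ...   | inj₂ (inj₂ x̄₃) = ⊥-elim (W-≢ 3 5 (sym (N[v]∋v̄⇒≡ (SameTrace-transfer (SameTrace-sym same)
                            (trans (xb'-kept 3 (W-≢ 3 7)) x̄₃) (N[v]∋v̄ (W 3))))))

        detects-from-v₆ : ∀ w → SameTrace D' (inj₁ (W 6)) w → N[ w ]∋ inj₁ (W 6)
        detects-from-v₆ (inj₂ r) same = ⊥-elim (v≁v̄ x' xb' spread' (W 6) r same)
        detects-from-v₆ (inj₁ r) same with N[v]∋v̄⇒≡ (SameTrace-transfer same x̄'₆ (N[v]∋v̄ (W 6)))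
        ... | refl = N[]∋self _

        detects-from-v₇ : ∀ w → SameTrace D' (inj₁ (W 7)) w → N[ w ]∋ inj₁ (W 6)
        detects-from-v₇ (inj₂ r) same = ⊥-elim (v≁v̄ x' xb' spread' (W 7) r same)
        detects-from-v₇ (inj₁ r) same with N[v]∋v̄⇒≡ (SameTrace-transfer same x̄'₇ (N[v]∋v̄ (W 7)))
        ... | refl = N[vW]∋vW-pred 6

        detects-from-v̄₆ : ∀ w → SameTrace D' (inj₂ (W 6)) w → N[ w ]∋ inj₁ (W 6)
        detects-from-v̄₆ (inj₁ r) same = ⊥-elim (v̄≁v x' xb' spread' r (W 6) same)
        detects-from-v̄₆ (inj₂ r) same
            with N[v̄]∌v̄W⇒ 6 r (λ ∋₇ → N[v̄]∌adjacent (step 6) (SameTrace-transfer (SameTrace-sym same) x̄'₇ ∋₇))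
        ... | inj₁ refl = N[v̄]∋v (W 6)
        ... | inj₂ refl = ⊥-elim (N[v̄]∌adjacent (step 8)
                            (SameTrace-transfer same x̄'₉ (N[v̄W]∋v̄ 5 (W 9) (W-≢' 5 9) (W-≢' 7 9))))

        detects : Detects D' (inj₁ (W 6))
        detects (inj₂ p) w same ∋ with N[v̄]∋v⇒≡ ∋
        ... | refl = detects-from-v̄₆ w same
        detects (inj₁ p) w same ∋ with N[v]∋vW⇒ 5 p ∋
        ... | inj₁ refl = detects-from-v₅ v₅-kept w same
        ... | inj₂ (inj₁ refl) = detects-from-v₆ w same
        ... | inj₂ (inj₂ refl) = detects-from-v₇ w same

      5≤ : 5 ≤ countT xb
      5≤ = ≤-trans (m≤m+n 5 1) 6≤

      move-v̄₆-to-v₇ : x (W 5) ≡ true → Improvable x xb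
      move-v̄₆-to-v₇ x₅ = improvable code 5≤ x₆ x̄₆ (x₇ , x̄₇) detects
        where
        open MoveToCycle x xb (W 6) (W 7)
        spread' : AvoidsAnyThree xb'
        spread' = spread 5≤
        x'-kept : ∀ e → W e ≢ W 7 → x' (W e) ≡ x (W e)
        x'-kept e = update-≢ x (W 7) true
        x'₅ : x' (W 5) ≡ true
        x'₅ = trans (x'-kept 5 (W-≢ 5 7)) x₅
        x'₆ : x' (W 6) ≡ true
        x'₆ = trans (x'-kept 6 (W-≢ 6 7)) x₆
        x'₇ : x' (W 7) ≡ true
        x'₇ = update-≡ x (W 7) true

        detects-from-v₆ : ∀ w → SameTrace D' (inj₁ (W 6)) w → N[ w ]∋ inj₂ (W 6)
        detects-from-v₆ (inj₂ r) same = ⊥-elim (v≁v̄ x' xb' spread' (W 6) r same)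
        detects-from-v₆ (inj₁ r) same with N[v]∋vW⇒ 5 r (SameTrace-transfer same x'₆ (N[]∋self _))
        ... | inj₂ (inj₁ refl) = N[v]∋v̄ _
        ... | inj₁ refl = ⊥-elim (N[vW]∌vW 6 5 (W-≢ 5 6) (W-≢ 5 7) (W-≢ 5 8) (SameTrace-transfer same x'₇ (N[vW]∋vW-succ 6)))
        ... | inj₂ (inj₂ refl) = ⊥-elim (N[vW]∌vW 4 7 (W-≢' 4 7) (W-≢' 5 7) (W-≢' 6 7) (SameTrace-transfer same x'₅ (N[vW]∋vW-pred 5)))

        detects-from-v̄ : ∀ k → N[ inj₂ k ]∋ inj₂ (W 6) → ∀ w → SameTrace D' (inj₂ k) w → N[ w ]∋ inj₂ (W 6)
        detects-from-v̄ k ∋ (inj₁ r) same = ⊥-elim (v̄≁v x' xb' spread' r k same)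
        detects-from-v̄ k ∋ (inj₂ r) same with r ≟ W 5 | r ≟ W 7
        ... | yes refl | _ with N[v̄]∋v⇒≡ (SameTrace-transfer (SameTrace-sym same) x'₅ (N[v̄]∋v _))
        ...   | refl = ⊥-elim (N[v̄]∌adjacent (step 5) ∋)
        detects-from-v̄ k ∋ (inj₂ r) same | no _ | yes refl with N[v̄]∋v⇒≡ (SameTrace-transfer (SameTrace-sym same) x'₇ (N[v̄]∋v _))
        ...   | refl = ⊥-elim (N[v̄]∌adjacent (adjacent-sym (step 6)) ∋)
        detects-from-v̄ k ∋ (inj₂ r) same | no ≢₅ | no ≢₇ = N-sym (N[v̄W]∋v̄ 5 r ≢₅ ≢₇)

        detects : Detects D' (inj₂ (W 6))
        detects (inj₁ p) w same ∋ with N[v]∋v̄⇒≡ ∋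
        ... | refl = detects-from-v₆ w same
        detects (inj₂ k) w same ∋ = detects-from-v̄ k ∋ w same

      move-v̄₄-to-v₅ : x (W 4) ≡ true → xb (W 4) ≡ true → x (W 5) ≡ false → xb (W 5) ≡ false →
                      x (W 1) ≡ true → xb (W 2) ≡ true → Improvable x xb
      move-v̄₄-to-v₅ x₄ x̄₄ x₅ x̄₅ x₁ x̄₂ = improvable code 5≤ x₄ x̄₄ (x₅ , x̄₅) detects
        where
        open MoveToCycle x xb (W 4) (W 5)
        spread' : AvoidsAnyThree xb'
        spread' = spread 5≤
        x'-kept : ∀ e → W e ≢ W 5 → x' (W e) ≡ x (W e)
        x'-kept e = update-≢ x (W 5) true
        x'₁ : x' (W 1) ≡ true
        x'₁ = trans (x'-kept 1 (W-≢ 1 5)) x₁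
        x'₄ : x' (W 4) ≡ true
        x'₄ = trans (x'-kept 4 (W-≢ 4 5)) x₄
        x'₅ : x' (W 5) ≡ true
        x'₅ = update-≡ x (W 5) true
        x'₆ : x' (W 6) ≡ true
        x'₆ = trans (x'-kept 6 (W-≢' 5 6)) x₆
        x̄'₂ : xb' (W 2) ≡ true
        x̄'₂ = trans (update-≢ xb (W 4) false (W-≢ 2 4)) x̄₂

        detects-from-v₄ : ∀ w → SameTrace D' (inj₁ (W 4)) w → N[ w ]∋ inj₂ (W 4)
        detects-from-v₄ (inj₂ r) same = ⊥-elim (v≁v̄ x' xb' spread' (W 4) r same)
        detects-from-v₄ (inj₁ r) same with N[v]∋vW⇒ 3 r (SameTrace-transfer same x'₄ (N[]∋self _))
        ... | inj₂ (inj₁ refl) = N[v]∋v̄ _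
        ... | inj₁ refl = ⊥-elim (N[vW]∌vW 4 3 (W-≢ 3 4) (W-≢ 3 5) (W-≢ 3 6) (SameTrace-transfer same x'₅ (N[vW]∋vW-succ 4)))
        ... | inj₂ (inj₂ refl) = ⊥-elim (N[vW]∌vW 5 4 (W-≢ 4 5) (W-≢ 4 6) (W-≢ 4 7)
                                   (SameTrace-transfer (SameTrace-sym same) x'₆ (N[vW]∋vW-succ 5)))

        detects-from-v̄ : ∀ k → N[ inj₂ k ]∋ inj₂ (W 4) → ∀ w → SameTrace D' (inj₂ k) w → N[ w ]∋ inj₂ (W 4)
        detects-from-v̄ k ∋ (inj₁ r) same = ⊥-elim (v̄≁v x' xb' spread' r k same)
        detects-from-v̄ k ∋ (inj₂ r) same with r ≟ W 3 | r ≟ W 5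
        ... | no ≢₃ | no ≢₅ = N-sym (N[v̄W]∋v̄ 3 r ≢₃ ≢₅)
        ... | no _ | yes refl with N[v̄]∋v⇒≡ (SameTrace-transfer (SameTrace-sym same) x'₅ (N[v̄]∋v _))
        ...   | refl = ⊥-elim (N[v̄]∌adjacent (adjacent-sym (step 4)) ∋)
        detects-from-v̄ k ∋ (inj₂ r) same | yes refl | _
            with N[v̄]∌v̄W⇒ 1 k (λ ∋₂ → N[v̄]∌adjacent (adjacent-sym (step 2)) (SameTrace-transfer same x̄'₂ ∋₂))
        ... | inj₂ refl = ⊥-elim (N[v̄]∌adjacent (step 3) ∋)
        ... | inj₁ refl = ⊥-elim (W-≢ 1 3 (sym (N[v̄]∋v⇒≡ (SameTrace-transfer same x'₁ (N[v̄]∋v _)))))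

        detects : Detects D' (inj₂ (W 4))
        detects (inj₁ p) w same ∋ with N[v]∋v̄⇒≡ ∋
        ... | refl = detects-from-v₄ w same
        detects (inj₂ k) w same ∋ = detects-from-v̄ k ∋ w same

      v̄₆-detected : (xb' : Fin N → Bool) → AvoidsAnyThree xb' → x (W 4) ≡ true →
                    xb' (W 2) ≡ true → xb' (W 4) ≡ true → xb' (W 7) ≡ true → xb' (W 8) ≡ true →
                    Detects (codeOf x xb') (inj₂ (W 6))
      v̄₆-detected xb' spread' x₄ x̄'₂ x̄'₄ x̄'₇ x̄'₈ = detects
        where
        detects-from-v₆ : ∀ w → SameTrace (codeOf x xb') (inj₁ (W 6)) w → N[ w ]∋ inj₂ (W 6)
        detects-from-v₆ (inj₂ r) same = ⊥-elim (v≁v̄ x xb' spread' (W 6) r same)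
        detects-from-v₆ (inj₁ r) same with N[v]∋vW⇒ 5 r (SameTrace-transfer same x₆ (N[]∋self _))
        ... | inj₂ (inj₁ refl) = N[v]∋v̄ _
        ... | inj₁ refl = ⊥-elim (N[vW]∌vW 3 6 (W-≢' 3 6) (W-≢' 4 6) (W-≢' 5 6)
                            (SameTrace-transfer (SameTrace-sym same) x₄ (N[vW]∋vW-pred 4)))
        ... | inj₂ (inj₂ refl) = ⊥-elim (W-≢ 6 7 (N[v]∋v̄⇒≡ (SameTrace-transfer (SameTrace-sym same) x̄'₇ (N[v]∋v̄ _))))

        detects-from-v̄ : ∀ k → N[ inj₂ k ]∋ inj₂ (W 6) → ∀ w → SameTrace (codeOf x xb') (inj₂ k) w → N[ w ]∋ inj₂ (W 6)
        detects-from-v̄ k ∋ (inj₁ r) same = ⊥-elim (v̄≁v x xb' spread' r k same)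
        detects-from-v̄ k ∋ (inj₂ r) same with r ≟ W 5 | r ≟ W 7
        ... | no ≢₅ | no ≢₇ = N-sym (N[v̄W]∋v̄ 5 r ≢₅ ≢₇)
        ... | no _ | yes refl with N[v̄]∌v̄W⇒ 7 k (λ ∋₈ → N[v̄]∌adjacent (step 7) (SameTrace-transfer same x̄'₈ ∋₈))
        ...   | inj₁ refl = ⊥-elim (N[v̄]∌adjacent (adjacent-sym (step 6)) ∋)
        ...   | inj₂ refl = ⊥-elim (W-≢ 7 9 (N[v̄]∋v⇒≡ (SameTrace-transfer same x₉ (N[v̄]∋v _))))
        detects-from-v̄ k ∋ (inj₂ r) same | yes refl | _
            with N[v̄]∌v̄W⇒ 3 k (λ ∋₄ → N[v̄]∌adjacent (adjacent-sym (step 4)) (SameTrace-transfer same x̄'₄ ∋₄))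
        ... | inj₂ refl = ⊥-elim (N[v̄]∌adjacent (step 5) ∋)
        ... | inj₁ refl = ⊥-elim (N[v̄]∌adjacent (adjacent-sym (step 2))
                            (SameTrace-transfer (SameTrace-sym same) x̄'₂ (N[v̄W]∋v̄ 4 (W 2) (W-≢ 2 4) (W-≢ 2 6))))

        detects : Detects (codeOf x xb') (inj₂ (W 6))
        detects (inj₁ p) w same ∋ with N[v]∋v̄⇒≡ ∋
        ... | refl = detects-from-v₆ w same
        detects (inj₂ k) w same ∋ = detects-from-v̄ k ∋ w same

      flank : ¬ IbarAlong 1 → Improvable x xb ⊎ Flank
      flank ¬Ī with xb (W 5) in x̄₅ | x (W 5) in x₅
      ... | true | _ = inj₁ (move-v₆-to-v̄₇ (inj₁ x̄₅))
      ... | false | true = inj₁ (move-v̄₆-to-v₇ x₅)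
      ... | false | false = v₃-cases (x₄-separates-v₅-v₇ x₅ x̄₅ x₇ x₈ x̄₇) (x̄₄-separates-v̄₅-v̄₇ x₅ x₇ x̄₈)
        where
        v₃-cases : x (W 4) ≡ true → xb (W 4) ≡ true → Improvable x xb ⊎ Flank
        v₃-cases x₄ x̄₄ with x (W 3) in x₃ | x (W 2) in x₂ | xb (W 3) in x̄₃
        ... | true | _ | _ = inj₁ (move-v₆-to-v̄₇ (inj₂ (x₄ , x̄₄ , inj₁ x₃)))
        ... | false | true | _ = inj₁ (move-v₆-to-v̄₇ (inj₂ (x₄ , x̄₄ , inj₂ (inj₁ x₂))))
        ... | false | false | true = inj₁ (move-v₆-to-v̄₇ (inj₂ (x₄ , x̄₄ , inj₂ (inj₂ x̄₃))))
        ... | false | false | false = inj₂ (record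
          { x₅ = x₅ ; x̄₅ = x̄₅ ; x₄ = x₄ ; x̄₄ = x̄₄ ; x₃ = x₃ ; x₂ = x₂ ; x̄₃ = x̄₃
          ; x̄₁ = ¬-not {y = false} λ x̄₁ → ¬Ī (x̄₁ , refl , refl) })

      flank-end : Flank → Improvable x xb ⊎ PatternAlong 1 ⊎ xb (W 2) ≡ true
      flank-end f = v₁-cases
        where
        open Flank f
        aligned : x (W 1) ≡ true → xb (W 2) ≡ false → PatternAlong 1
        aligned x₁ x̄₂ fzero = x̄₁ , x₁
        aligned x₁ x̄₂ (fsuc fzero) = x̄₂ , x₂
        aligned x₁ x̄₂ (fsuc (fsuc fzero)) = x̄₃ , x₃
        aligned x₁ x̄₂ (fsuc (fsuc (fsuc fzero))) = x̄₄ , x₄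
        aligned x₁ x̄₂ (fsuc (fsuc (fsuc (fsuc fzero)))) = x̄₅ , x₅
        aligned x₁ x̄₂ (fsuc (fsuc (fsuc (fsuc (fsuc fzero))))) = x̄₆ , x₆
        aligned x₁ x̄₂ (fsuc (fsuc (fsuc (fsuc (fsuc (fsuc fzero)))))) = x̄₇ , x₇
        aligned x₁ x̄₂ (fsuc (fsuc (fsuc (fsuc (fsuc (fsuc (fsuc fzero))))))) = x̄₈ , x₈
        aligned x₁ x̄₂ (fsuc (fsuc (fsuc (fsuc (fsuc (fsuc (fsuc (fsuc fzero)))))))) = x̄₉ , x₉
        v₁-cases : Improvable x xb ⊎ PatternAlong 1 ⊎ xb (W 2) ≡ true
        v₁-cases with x (W 1) in x₁
        ... | false = inj₂ (inj₂ (x̄-forced 1 x₁ x₂ x₃))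
        ... | true with xb (W 2) in x̄₂
        ...   | true = inj₁ (move-v̄₄-to-v₅ x₄ x̄₄ x₅ x̄₅ x₁ x̄₂)
        ...   | false = inj₂ (inj₁ (aligned x₁ x̄₂))

  module Mirror (x xb : Fin N → Bool) (code : IsIdentifyingCode G (codeOf x xb)) (6≤ : 6 ≤ countT xb)
                (forth back : Traversal) (mirror : ∀ e → {T (e ≤ᵇ 15)} → Traversal.W back e ≡ Traversal.W forth (15 ∸ e)) where
    module F = Around forth x xb code 6≤
    module B = Around back x xb code 6≤
    open F using (W) public

    at-mirror : ∀ (f : Fin N → Bool) {v} e → {e≤15 : T (e ≤ᵇ 15)} → f (W (15 ∸ e)) ≡ v → f (B.W e) ≡ v
    at-mirror f e {e≤15} fe = trans (cong f (mirror e {e≤15})) fe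

    from-mirror : ∀ (f : Fin N → Bool) {v} e → {e≤15 : T (e ≤ᵇ 15)} → f (B.W e) ≡ v → f (W (15 ∸ e)) ≡ v
    from-mirror f e {e≤15} fe = trans (cong f (sym (mirror e {e≤15}))) fe

    mirror-centre : F.Centre → B.Centre
    mirror-centre c = record
      { x₆ = at-mirror x 6 x₉ ; x̄₆ = at-mirror xb 6 x̄₉ ; x₇ = at-mirror x 7 x₈ ; x̄₇ = at-mirror xb 7 x̄₈
      ; x₈ = at-mirror x 8 x₇ ; x̄₈ = at-mirror xb 8 x̄₇ ; x₉ = at-mirror x 9 x₆ ; x̄₉ = at-mirror xb 9 x̄₆ }
      where open F.Centre c

    mirror-IbarAlong : B.IbarAlong 1 → F.IbarAlong 12
    mirror-IbarAlong (x̄₁ , x₂ , x̄₃) = from-mirror xb 3 x̄₃ , from-mirror x 2 x₂ , from-mirror xb 1 x̄₁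

    mirror-pattern : B.PatternAlong 1 → F.PatternAlong 6
    mirror-pattern p k = subst (λ q → xb q ≡ lookup pattern9 k × x q ≡ lookup pattern9 k) position
      (subst (λ v → xb (B.W e) ≡ v × x (B.W e) ≡ v) (pattern9-palindrome k) (p (opposite k)))
      where
      e = 1 + toℕ (opposite k)
      k≤8 : toℕ k ≤ 8
      k≤8 = ≤-pred (toℕ<n k)
      index : 15 ∸ e ≡ 6 + toℕ k
      index = begin
        14 ∸ toℕ (opposite k)    ≡⟨ cong (14 ∸_) (opposite-prop k) ⟩
        14 ∸ (8 ∸ toℕ k)         ≡⟨ +-∸-assoc 6 (m∸n≤m 8 (toℕ k)) ⟩
        6 + (8 ∸ (8 ∸ toℕ k))    ≡⟨ cong (6 +_) (m∸[m∸n]≡n k≤8) ⟩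
        6 + toℕ k                ∎
        where open ≡-Reasoning
      position : B.W e ≡ W (6 + toℕ k)
      position = trans (mirror e {≤⇒≤ᵇ (≤-trans (toℕ<n (opposite k)) (m≤m+n 9 6))}) (cong W index)

    move-v̄₆v̄₉-to-v̄₇v̄₈ : F.Centre → x (W 4) ≡ true → xb (W 4) ≡ true → x (W 11) ≡ true → xb (W 11) ≡ true →
                          xb (W 2) ≡ true → xb (W 13) ≡ true → Improvable x xb
    move-v̄₆v̄₉-to-v̄₇v̄₈ c x₄ x̄₄ x₁₁ x̄₁₁ x̄₂ x̄₁₃ = x , xb' , code' , size , zeros
      where
      open F.Centre c
      xb₁ xb₂ xb₃ xb' : Fin N → Bool
      xb₁ = update xb (W 6) false
      xb₂ = update xb₁ (W 9) false
      xb₃ = update xb₂ (W 7) true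
      xb' = update xb₃ (W 8) true

      D' : Vertex → Bool
      D' = codeOf x xb'

      kept : ∀ q → q ≢ W 6 → q ≢ W 9 → xb q ≡ true → xb' q ≡ true
      kept q ≢₆ ≢₉ xbq = update-true-mono xb₃ (W 8) q (update-true-mono xb₂ (W 7) q
        (trans (update-≢ xb₁ (W 9) false ≢₉) (trans (update-≢ xb (W 6) false ≢₆) xbq)))

      removed : ∀ q → xb q ≡ true → xb' q ≡ false → q ≡ W 6 ⊎ q ≡ W 9
      removed q xbq xb'q with q ≟ W 6 | q ≟ W 9
      ... | yes q≡W₆ | _ = inj₁ q≡W₆
      ... | no _ | yes q≡W₉ = inj₂ q≡W₉
      ... | no ≢₆ | no ≢₉ = ⊥-elim (clash (kept q ≢₆ ≢₉ xbq) xb'q)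

      spread : AvoidsAnyThree xb'
      spread = avoidsAnyThree xb xb' (W 6 ∷ W 9 ∷ []) 6≤
        λ t xbt t∉ → kept t (λ e → t∉ (here e)) (λ e → t∉ (there (here e))) xbt

      x̄'₂ : xb' (W 2) ≡ true
      x̄'₂ = kept (W 2) (F.W-≢ 2 6) (F.W-≢ 2 9) x̄₂
      x̄'₄ : xb' (W 4) ≡ true
      x̄'₄ = kept (W 4) (F.W-≢ 4 6) (F.W-≢ 4 9) x̄₄
      x̄'₇ : xb' (W 7) ≡ true
      x̄'₇ = update-true-mono xb₃ (W 8) (W 7) (update-≡ xb₂ (W 7) true)
      x̄'₈ : xb' (W 8) ≡ true
      x̄'₈ = update-≡ xb₃ (W 8) true
      x̄'₁₁ : xb' (W 11) ≡ true
      x̄'₁₁ = kept (W 11) (F.W-≢' 6 11) (F.W-≢' 9 11) x̄₁₁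
      x̄'₁₃ : xb' (W 13) ≡ true
      x̄'₁₃ = kept (W 13) (F.W-≢' 6 13) (F.W-≢' 9 13) x̄₁₃

      x-removed : ∀ q → q ≡ W 6 ⊎ q ≡ W 9 → x q ≡ true
      x-removed _ (inj₁ refl) = x₆
      x-removed _ (inj₂ refl) = x₉

      covers : ∀ q → q ≡ W 6 ⊎ q ≡ W 9 → Covers D' (inj₂ q)
      covers q _ (inj₂ k) _ = v̄-dominated x xb' spread k
      covers q q∈ (inj₁ p) ∋ with N[v]∋v̄⇒≡ ∋
      ... | refl = inj₁ p , x-removed p q∈ , N[]∋self _

      detects : ∀ q → q ≡ W 6 ⊎ q ≡ W 9 → Detects D' (inj₂ q)
      detects _ (inj₁ refl) = F.WithCentre.v̄₆-detected c xb' spread x₄ x̄'₂ x̄'₄ x̄'₇ x̄'₈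
      detects _ (inj₂ refl) = subst (λ q → Detects D' (inj₂ q)) (mirror 6)
        (B.WithCentre.v̄₆-detected (mirror-centre c) xb' spread (at-mirror x 4 x₁₁)
          (at-mirror xb' 2 x̄'₁₃) (at-mirror xb' 4 x̄'₁₁) (at-mirror xb' 7 x̄'₈) (at-mirror xb' 8 x̄'₇))

      lost : ∀ z → codeOf x xb z ≡ true → D' z ≡ false → Covers D' z × Detects D' z
      lost (inj₁ r) xr x'r = ⊥-elim (clash xr x'r)
      lost (inj₂ q) xbq xb'q = covers q (removed q xbq xb'q) , detects q (removed q xbq xb'q)

      code' : IsIdentifyingCode G D'
      code' = identifying-exchange (codeOf x xb) D' code lost

      countT-xb' : countT xb' ≡ countT xb
      countT-xb' = begin
        countT xb'                 ≡⟨ countT-update-true xb₃ (W 8) xb₃₈ ⟩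
        suc (countT xb₃)           ≡⟨ cong suc (countT-update-true xb₂ (W 7) xb₂₇) ⟩
        suc (suc (countT xb₂))     ≡⟨ cong suc (countT-update-false xb₁ (W 9) xb₁₉) ⟨
        suc (countT xb₁)           ≡⟨ countT-update-false xb (W 6) x̄₆ ⟨
        countT xb                  ∎
        where
        open ≡-Reasoning
        xb₁₉ : xb₁ (W 9) ≡ true
        xb₁₉ = trans (update-≢ xb (W 6) false (F.W-≢' 6 9)) x̄₉
        xb₂₇ : xb₂ (W 7) ≡ false
        xb₂₇ = trans (update-≢ xb₁ (W 9) false (F.W-≢ 7 9)) (trans (update-≢ xb (W 6) false (F.W-≢' 6 7)) x̄₇)
        xb₃₈ : xb₃ (W 8) ≡ false
        xb₃₈ = trans (update-≢ xb₂ (W 7) true (F.W-≢' 7 8))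
          (trans (update-≢ xb₁ (W 9) false (F.W-≢ 8 9)) (trans (update-≢ xb (W 6) false (F.W-≢' 6 8)) x̄₈))

      size : codeSize x xb' ≤ codeSize x xb
      size = ≤-reflexive (cong (countT x +_) countT-xb')

      zeros : zeroCount x xb' < zeroCount x xb
      zeros = zeroCount-< x xb x xb' (W 7) no-new-zero (x₇ , x̄₇) λ (_ , xb'₇) → clash x̄'₇ xb'₇
        where
        no-new-zero : ∀ q → BothFalse x xb' q → BothFalse x xb q
        no-new-zero q (xq , xb'q) = xq , ¬-not λ xbq → clash (x-removed q (removed q xbq xb'q)) xq

    improvable-or-aligned : F.Centre → ¬ F.IbarAlong 1 → ¬ B.IbarAlong 1 → Improvable x xb ⊎ (F.PatternAlong 6 ⊎ F.PatternAlong 1)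
    improvable-or-aligned c ¬Īₗ ¬Īᵣ with F.WithCentre.flank c ¬Īₗ | B.WithCentre.flank (mirror-centre c) ¬Īᵣ
    ... | inj₁ better | _ = inj₁ better
    ... | inj₂ _ | inj₁ better = inj₁ better
    ... | inj₂ fₗ | inj₂ fᵣ with F.WithCentre.flank-end c fₗ | B.WithCentre.flank-end (mirror-centre c) fᵣ
    ...   | inj₁ better | _ = inj₁ better
    ...   | inj₂ (inj₁ aligned) | _ = inj₂ (inj₂ aligned)
    ...   | inj₂ (inj₂ _) | inj₁ better = inj₁ better
    ...   | inj₂ (inj₂ _) | inj₂ (inj₁ aligned) = inj₂ (inj₁ (mirror-pattern aligned))
    ...   | inj₂ (inj₂ x̄₂) | inj₂ (inj₂ x̄₁₃) =
            inj₁ (move-v̄₆v̄₉-to-v̄₇v̄₈ c (F.Flank.x₄ fₗ) (F.Flank.x̄₄ fₗ)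
                   (from-mirror x 4 (B.Flank.x₄ fᵣ)) (from-mirror xb 4 (B.Flank.x̄₄ fᵣ)) x̄₂ (from-mirror xb 2 x̄₁₃))

  module AtIndex (x xb : Fin N → Bool) (code : IsIdentifyingCode G (codeOf x xb)) (6≤ : 6 ≤ countT xb) (i : Fin N) where
    start : Fin N
    start = unshift i 7

    open Mirror x xb code 6≤ (forward start) (backward (forwardFrom start 15))
                (λ e {e≤15} → backward-forward start e (≤ᵇ⇒≤ e 15 e≤15)) public

    7≤N : 7 ≤ N
    7≤N = ≤-trans (m≤m+n 7 2) 9≤N

    W-right : ∀ k → W (7 + k) ≡ shift i k
    W-right k = begin
      forwardFrom start (7 + k)       ≡⟨ forwardFrom-+ start 0 (7 + k) ⟩
      shift start (7 + k)             ≡⟨ shift-shift i (N ∸ 7) (7 + k) ⟩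
      shift i (N ∸ 7 + (7 + k))       ≡⟨ cong (shift i) (trans (sym (+-assoc (N ∸ 7) 7 k)) (cong (_+ k) (m∸n+n≡m 7≤N))) ⟩
      shift i (N + k)                 ≡⟨ shift-shift i N k ⟨
      shift (shift i N) k             ≡⟨ cong (λ q → shift q k) (shift-N i) ⟩
      shift i k                       ∎
      where open ≡-Reasoning

    W-left : ∀ k → {T (k ≤ᵇ 7)} → W (7 ∸ k) ≡ unshift i k
    W-left k {k≤7} = begin
      forwardFrom start (7 ∸ k)       ≡⟨ forwardFrom-+ start 0 (7 ∸ k) ⟩
      shift start (7 ∸ k)             ≡⟨ shift-shift i (N ∸ 7) (7 ∸ k) ⟩
      shift i (N ∸ 7 + (7 ∸ k))       ≡⟨ cong (shift i) (trans (sym (+-∸-assoc (N ∸ 7) (≤ᵇ⇒≤ k 7 k≤7))) (cong (_∸ k) (m∸n+n≡m 7≤N))) ⟩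
      shift i (N ∸ k)                 ∎
      where open ≡-Reasoning

    PatternAlong⇒PatternAt : ∀ a → F.PatternAlong a → PatternAt x xb (W a)
    PatternAlong⇒PatternAt a aligned k rewrite sym (forwardFrom-+ start a (toℕ k)) = aligned k

    IbarAlong⇒InIbar : ∀ e → F.IbarAlong e → InIbar x xb (W (suc e))
    IbarAlong⇒InIbar e (x̄₀ , x₁ , x̄₂) = trans (cong xb (prev-next (W e))) x̄₀ , x₁ , x̄₂

    W₇ : W 7 ≡ i
    W₇ = trans (W-right 0) (shift-0 i)

    centre : ¬ InIbar x xb i → ¬ InIbar x xb (shift i 1) →
             xb i ≡ false → xb (shift i 1) ≡ false → x i ≡ false → x (shift i 1) ≡ false → F.Centre
    centre ¬Ī₇ ¬Ī₈ x̄ᵢ x̄ᵢ₊₁ xᵢ xᵢ₊₁ = record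
      { x₆ = F.x-before-forced 6 x₇ x₈ x̄₇ ; x̄₆ = x̄₆ ; x₇ = x₇ ; x̄₇ = x̄₇
      ; x₈ = x₈ ; x̄₈ = x̄₈ ; x₉ = F.x-after-forced 7 x₇ x₈ x̄₈ ; x̄₉ = x̄₉ }
      where
      x₇ = trans (cong x W₇) xᵢ
      x̄₇ = trans (cong xb W₇) x̄ᵢ
      x₈ = trans (cong x (W-right 1)) xᵢ₊₁
      x̄₈ = trans (cong xb (W-right 1)) x̄ᵢ₊₁
      x̄₆ : xb (W 6) ≡ true
      x̄₆ = ¬-not {y = false} λ x̄₆ → ¬Ī₇ (subst (InIbar x xb) W₇ (IbarAlong⇒InIbar 6 (x̄₆ , x₇ , x̄₈)))
      x̄₉ : xb (W 9) ≡ true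
      x̄₉ = ¬-not {y = false} λ x̄₉ → ¬Ī₈ (subst (InIbar x xb) (W-right 1) (IbarAlong⇒InIbar 7 (x̄₇ , x₈ , x̄₉)))

    left-Ibar : ¬ InIbar x xb (unshift i 5) → ¬ F.IbarAlong 1
    left-Ibar ¬Ī Ī = ¬Ī (subst (InIbar x xb) (W-left 5) (IbarAlong⇒InIbar 1 Ī))

    right-Ibar : ¬ InIbar x xb (shift i 6) → ¬ B.IbarAlong 1
    right-Ibar ¬Ī Ī = ¬Ī (subst (InIbar x xb) (W-right 6) (IbarAlong⇒InIbar 12 (mirror-IbarAlong Ī)))

    aligned-at : F.PatternAlong 6 ⊎ F.PatternAlong 1 → PatternAt x xb (unshift i 1) ⊎ PatternAt x xb (unshift i 6)
    aligned-at = Sum.map (subst (PatternAt x xb) (W-left 1) ∘ PatternAlong⇒PatternAt 6)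
                         (subst (PatternAt x xb) (W-left 6) ∘ PatternAlong⇒PatternAt 1)

lemma3 : (n : ℕ) → 9 ≤ n → (x xb : Fin n → Bool) →
    IsIdentifyingCode (CnBar n) (codeOf x xb) →
    6 ≤ countT xb →
    (i : Fin n) →
    ¬ InIbar x xb (unshift i 5) → ¬ InIbar x xb i →
    ¬ InIbar x xb (shift i 1) → ¬ InIbar x xb (shift i 6) →
    xb i ≡ false → xb (shift i 1) ≡ false →
    x i ≡ false → x (shift i 1) ≡ false →
    (∃₂ λ (x' xb' : Fin n → Bool) →
        IsIdentifyingCode (CnBar n) (codeOf x' xb')
        × codeSize x' xb' ≤ codeSize x xb
        × zeroCount x' xb' < zeroCount x xb)
    ⊎ (PatternAt x xb (unshift i 1) ⊎ PatternAt x xb (unshift i 6))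
lemma3 (suc m) 9≤N x xb code 6≤ i ¬Ī₋₅ ¬Ī₀ ¬Ī₁ ¬Ī₆ x̄ᵢ x̄ᵢ₊₁ xᵢ xᵢ₊₁ =
  Sum.map₂ aligned-at (improvable-or-aligned (centre ¬Ī₀ ¬Ī₁ x̄ᵢ x̄ᵢ₊₁ xᵢ xᵢ₊₁) (left-Ibar ¬Ī₋₅) (right-Ibar ¬Ī₆))
  where open Prism.AtIndex m 9≤N x xb code 6≤ i
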